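{- Let $T_n$ be the chain triangular cactus with $n$ triangles. Then for every $n\ge 2$ and $k\ge 1$: (i) $Mo(T_n)=12k^2-4k$ if $n=2k$, and $Mo(T_n)=12k^2+8k$ if $n=2k+1$; (ii) $Mo_e(T_n)=18k^2-6k$ if $n=2k$, and $Mo_e(T_n)=18k^2+12k$ if $n=2k+1$.
   Context: The chain triangular cactus $T_n$ consists of $n$ triangles $\Delta_1,\ldots,\Delta_n$ such that $\Delta_i$ and $\Delta_{i+1}$ share exactly one vertex for $i=1,\ldots,n-1$, non-consecutive triangles are vertex-disjoint, and for $2\le i\le n-1$ the vertex $\Delta_i$ shares with $\Delta_{i-1}$ is different from the vertex it shares with $\Delta_{i+1}$ (so $T_n$ has $2n+1$ vertices and $3n$ edges). For a graph $G$ and an edge $e=uv$, $n_u(e,G)$ denotes the number of vertices of $G$ strictly closer to $u$ than to $v$ (and $n_v(e,G)$ analogously). The Mostar index is $Mo(G)=\sum_{uv\in E(G)}|n_u(uv,G)-n_v(uv,G)|$. For a vertex $w$ and an edge $f=ab$ put $d(w,f)=\min\{d(w,a),d(w,b)\}$; $m_u(e|G)$ is the number of edges $f$ of $G$ with $d(u,f)<d(v,f)$, and $m_v(e|G)$ analogously. The edge Mostar index is $Mo_e(G)=\sum_{e=uv\in E(G)}|m_u(e|G)-m_v(e|G)|$. -}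

module Defs where

open import Data.Nat using (ℕ; zero; suc; _+_; _*_; _<ᵇ_; _≡ᵇ_; ∣_-_∣)
open import Data.Bool using (Bool; true; false; _∨_; _∧_; if_then_else_)
open import Data.List using (List; []; _∷_; _++_; map; length; filterᵇ; upTo; concatMap)
open import Data.Bool.ListAction using (any)
open import Data.Nat.ListAction using (sum)
open import Data.Product using (_×_; _,_; proj₁; proj₂)
open import Data.Nat using (_⊓_)
open import Relation.Binary.PropositionalEquality using (_≡_)
open import Data.Bool using (T)

-- A finite simple graph: vertices 0 .. V-1, and a list of (undirected) edges,
-- each edge listed exactly once.
record Graph : Set where
  constructor graph
  field
    V : ℕ
    E : List (ℕ × ℕ)
open Graph public

vertices : Graph → List ℕ
vertices G = upTo (V G)

adj : Graph → ℕ → ℕ → Bool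
adj G u v = any (λ e → ((proj₁ e ≡ᵇ u) ∧ (proj₂ e ≡ᵇ v)) ∨ ((proj₁ e ≡ᵇ v) ∧ (proj₂ e ≡ᵇ u))) (E G)

elem : ℕ → List ℕ → Bool
elem x xs = any (λ y → y ≡ᵇ x) xs

ball : Graph → ℕ → ℕ → List ℕ
ball G zero u = u ∷ []
ball G (suc k) u =
  filterᵇ (λ w → any (λ x → (x ≡ᵇ w) ∨ adj G x w) (ball G k u))
         (vertices G)

-- distance: least k such that v lies within k steps of u
-- (searching k = 0 .. V; in a connected graph the distance is < V)
distFrom : Graph → ℕ → ℕ → ℕ → ℕ → ℕ
distFrom G u v k zero = k
distFrom G u v k (suc fuel) = if elem v (ball G k u) then k else distFrom G u v (suc k) fuel

dist : Graph → ℕ → ℕ → ℕ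
dist G u v = distFrom G u v 0 (V G)

count : {A : Set} → (A → Bool) → List A → ℕ
count p xs = length (filterᵇ p xs)

nVert : Graph → ℕ → ℕ → ℕ
nVert G u v = count (λ w → dist G w u <ᵇ dist G w v) (vertices G)

Mo : Graph → ℕ
Mo G = sum (map (λ e → ∣ nVert G (proj₁ e) (proj₂ e) - nVert G (proj₂ e) (proj₁ e) ∣) (E G))

distVE : Graph → ℕ → ℕ × ℕ → ℕ
distVE G w f = dist G w (proj₁ f) ⊓ dist G w (proj₂ f)

mEdge : Graph → ℕ → ℕ → ℕ
mEdge G u v = count (λ f → distVE G u f <ᵇ distVE G v f) (E G)

Moe : Graph → ℕ
Moe G = sum (map (λ e → ∣ mEdge G (proj₁ e) (proj₂ e) - mEdge G (proj₂ e) (proj₁ e) ∣) (E G))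

-- Chain triangular cactus T_n: vertices 0 .. 2n, triangle Δ_{i+1} (i = 0..n-1)
-- on vertices 2i, 2i+1, 2i+2; consecutive triangles share vertex 2i+2.
triangleEdges : ℕ → List (ℕ × ℕ)
triangleEdges i = (2 * i , 2 * i + 1) ∷ (2 * i + 1 , 2 * i + 2) ∷ (2 * i , 2 * i + 2) ∷ []

chainCactus : ℕ → Graph
chainCactus n = graph (2 * n + 1) (concatMap triangleEdges (upTo n))

-- Let s be the corner of triangle i (vertices 2i, 2i+1, 2i+2) nearest to a vertex w; the distances
-- from w to the three corners are d at s and d + 1 at the other two (cactusDist-corner). Hence, for
-- an edge ab of triangle i, w is strictly closer to a than to b iff s = a, so n_a(ab) is the number
-- of vertices of the branch of T_n hanging at a: 2i + 1, 1 or 2r + 1, where r = n - 1 - i. Likewise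
-- m_a(ab) = 1 + 3i, 1 or 1 + 3r, the 1 being the side of triangle i opposite b. Triangle i therefore
-- contributes 4 max(i, r) to Mo and 6 max(i, r) to Moe, and summing max(i, n - 1 - i) over i < n
-- gives 3k² - k for n = 2k and 3k² + 2k for n = 2k + 1. That the breadth-first distance dist is
-- the closed form cactusDist follows because cactusDist changes by at most 1 along an edge and every
-- vertex other than the source has a neighbour one step closer to it.

module Submission where

open import Defs
open import Data.Nat using (ℕ; _+_; _*_; _∸_; _≥_)
open import Data.Product using (_×_)
open import Relation.Binary.PropositionalEquality using (_≡_)

open import Data.Bool using (Bool; true; false; T; _∧_; _∨_)
open import Data.Bool.Properties using (T-∨; T-∧)
open import Data.Empty using (⊥-elim)
open import Data.List using (List; []; _∷_; _++_; map; applyUpTo; upTo; concatMap)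
open import Data.List.Properties using (map-cong; map-++; applyUpTo-∷ʳ; map-upTo)
import Data.List.Relation.Unary.Any as Any
open import Data.List.Relation.Unary.Any using (Any; here; there; satisfied)
open import Data.List.Relation.Unary.Any.Properties using (any⁺; any⁻; concatMap⁺; concatMap⁻; applyUpTo⁺)
open import Data.List.Membership.Propositional using (_∈_; find; lose)
open import Data.List.Membership.Propositional.Properties using (∈-filter⁺; ∈-filter⁻; ∈-upTo⁺; ∈-upTo⁻)
open import Data.Nat using (suc; zero; _<_; _≤_; _⊔_; _⊓_; _<ᵇ_; _≡ᵇ_; ∣_-_∣; z≤n; s≤s; s≤s⁻¹; _≤?_)
open import Data.Nat.ListAction using (sum)
open import Data.Nat.ListAction.Properties using (sum-++)
open import Data.Nat.Properties
open import Data.Nat.Tactic.RingSolver using (solve; solve-∀)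
open import Data.Product using (∃; _,_; proj₁; proj₂)
open import Data.Sum using (_⊎_; inj₁; inj₂)
open import Function using (_∘_; Equivalence)
open import Relation.Binary.PropositionalEquality using (_≢_; refl; sym; trans; cong; cong₂; subst; module ≡-Reasoning)
open import Relation.Nullary using (yes; no; contradiction)
open import Relation.Nullary.Decidable using (T?)
open Equivalence using (to; from)

private variable f g : ℕ → ℕ

𝟙 : Bool → ℕ
𝟙 true = 1
𝟙 false = 0

count≡sum : ∀ {A : Set} (p : A → Bool) xs → count p xs ≡ sum (map (𝟙 ∘ p) xs)
count≡sum p [] = refl
count≡sum p (x ∷ xs) with p x
... | true = cong suc (count≡sum p xs)
... | false = count≡sum p xs

sum-map-concatMap : ∀ {A B : Set} (h : B → ℕ) (f : A → List B) xs →
  sum (map h (concatMap f xs)) ≡ sum (map (sum ∘ map h ∘ f) xs)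
sum-map-concatMap h f [] = refl
sum-map-concatMap h f (x ∷ xs) = begin
  sum (map h (f x ++ concatMap f xs))              ≡⟨ cong sum (map-++ h (f x) _) ⟩
  sum (map h (f x) ++ map h (concatMap f xs))      ≡⟨ sum-++ (map h (f x)) _ ⟩
  sum (map h (f x)) + sum (map h (concatMap f xs)) ≡⟨ cong (sum (map h (f x)) +_) (sum-map-concatMap h f xs) ⟩
  sum (map h (f x)) + sum (map (sum ∘ map h ∘ f) xs) ∎
  where open ≡-Reasoning

sum-applyUpTo-cong : ∀ n → (∀ {i} → i < n → f i ≡ g i) →
  sum (applyUpTo f n) ≡ sum (applyUpTo g n)
sum-applyUpTo-cong zero eq = refl
sum-applyUpTo-cong (suc n) eq = cong₂ _+_ (eq (s≤s z≤n)) (sum-applyUpTo-cong n (eq ∘ s≤s))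

sum-applyUpTo-const : ∀ n {c} → (∀ {i} → i < n → f i ≡ c) → sum (applyUpTo f n) ≡ n * c
sum-applyUpTo-const zero eq = refl
sum-applyUpTo-const (suc n) eq = cong₂ _+_ (eq (s≤s z≤n)) (sum-applyUpTo-const n (eq ∘ s≤s))

sum-applyUpTo-piecewise : ∀ m r {x y z} → (∀ {i} → i < m → f i ≡ x) → f m ≡ y →
  (∀ {i} → m < i → i < suc (m + r) → f i ≡ z) →
  sum (applyUpTo f (suc (m + r))) ≡ y + (m * x + r * z)
sum-applyUpTo-piecewise zero r below at above =
  cong₂ _+_ at (sum-applyUpTo-const r (λ i<r → above (s≤s z≤n) (s≤s i<r)))
sum-applyUpTo-piecewise {f} (suc m) r {x} {y} {z} below at above = begin
  f 0 + sum (applyUpTo (f ∘ suc) (suc (m + r))) ≡⟨ cong₂ _+_ (below (s≤s z≤n))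
    (sum-applyUpTo-piecewise m r (below ∘ s≤s) at (λ m<i i<n → above (s≤s m<i) (s≤s i<n))) ⟩
  x + (y + (m * x + r * z))                    ≡⟨ solve (x ∷ y ∷ z ∷ m ∷ r ∷ []) ⟩
  y + (suc m * x + r * z)                      ∎
  where open ≡-Reasoning

sum-applyUpTo-* : ∀ c (f : ℕ → ℕ) n → sum (applyUpTo (λ i → c * f i) n) ≡ c * sum (applyUpTo f n)
sum-applyUpTo-* c f zero = sym (*-zeroʳ c)
sum-applyUpTo-* c f (suc n) =
  trans (cong (c * f 0 +_) (sum-applyUpTo-* c (f ∘ suc) n)) (sym (*-distribˡ-+ c (f 0) _))

sum-applyUpTo-suc : ∀ (f : ℕ → ℕ) n → sum (applyUpTo (suc ∘ f) n) ≡ n + sum (applyUpTo f n)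
sum-applyUpTo-suc f zero = refl
sum-applyUpTo-suc f (suc n) = cong suc (trans (cong (f 0 +_) (sum-applyUpTo-suc (f ∘ suc) n))
  (swap (f 0) n (sum (applyUpTo (f ∘ suc) n))))
  where
    swap : ∀ a b c → a + (b + c) ≡ b + (a + c)
    swap = solve-∀

sum-applyUpTo-last : ∀ (f : ℕ → ℕ) n → sum (applyUpTo f (suc n)) ≡ sum (applyUpTo f n) + f n
sum-applyUpTo-last f n = begin
  sum (applyUpTo f (suc n))                 ≡⟨ cong sum (applyUpTo-∷ʳ f n) ⟨
  sum (applyUpTo f n ++ f n ∷ [])           ≡⟨ sum-++ (applyUpTo f n) (f n ∷ []) ⟩
  sum (applyUpTo f n) + (f n + 0)           ≡⟨ cong (sum (applyUpTo f n) +_) (+-identityʳ (f n)) ⟩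
  sum (applyUpTo f n) + f n                 ∎
  where open ≡-Reasoning

<ᵇ-cancelˡ : ∀ d m n → (d + m <ᵇ d + n) ≡ (m <ᵇ n)
<ᵇ-cancelˡ zero m n = refl
<ᵇ-cancelˡ (suc d) m n = <ᵇ-cancelˡ d m n

<ᵇ-cancelʳ : ∀ d m n → (m + d <ᵇ n + d) ≡ (m <ᵇ n)
<ᵇ-cancelʳ d m n = trans (cong₂ _<ᵇ_ (+-comm m d) (+-comm n d)) (<ᵇ-cancelˡ d m n)

+-∣-∣≡2*⊔ : ∀ m n → m + (n + ∣ m - n ∣) ≡ 2 * (m ⊔ n)
+-∣-∣≡2*⊔ zero n = cong (n +_) (sym (+-identityʳ n))
+-∣-∣≡2*⊔ (suc m) zero = cong (suc m +_) (sym (+-identityʳ (suc m)))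
+-∣-∣≡2*⊔ (suc m) (suc n) = begin
  suc m + (suc n + ∣ m - n ∣) ≡⟨ cong suc (+-suc m _) ⟩
  2 + (m + (n + ∣ m - n ∣))   ≡⟨ cong (2 +_) (+-∣-∣≡2*⊔ m n) ⟩
  2 + 2 * (m ⊔ n)             ≡⟨ *-suc 2 (m ⊔ n) ⟨
  2 * suc (m ⊔ n)             ∎
  where open ≡-Reasoning

2*[m*n⊔m*o]≡2*m*[n⊔o] : ∀ m n o → 2 * (m * n ⊔ m * o) ≡ 2 * m * (n ⊔ o)
2*[m*n⊔m*o]≡2*m*[n⊔o] m n o = trans (cong (2 *_) (sym (*-distribˡ-⊔ m n o))) (sym (*-assoc 2 m (n ⊔ o)))

m*o+n*0≡m*o : ∀ m n c → m * c + n * 0 ≡ m * c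
m*o+n*0≡m*o = solve-∀

m*0+n*o≡n*o : ∀ m n c → m * 0 + n * c ≡ n * c
m*0+n*o≡n*o = solve-∀

m*0+n*0≡0 : ∀ m n → m * 0 + n * 0 ≡ 0
m*0+n*0≡0 = solve-∀

elem⇒∈ : ∀ {v} xs → T (elem v xs) → v ∈ xs
elem⇒∈ xs t = Any.map (λ {y} e → sym (≡ᵇ⇒≡ y _ e)) (any⁻ _ xs t)

∈⇒elem : ∀ {v xs} → v ∈ xs → T (elem v xs)
∈⇒elem {v} v∈xs = any⁺ _ (Any.map (λ {refl → ≡⇒≡ᵇ v v refl}) v∈xs)

module BreadthFirstSearch
  (G : Graph) (u : ℕ) (δ : ℕ → ℕ) (u<V : u < V G) (δ-source : δ u ≡ 0)
  (δ≡0⇒source : ∀ {x} → δ x ≡ 0 → x ≡ u)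
  (δ-lipschitz : ∀ {y x} → T (adj G y x) → δ x ≤ suc (δ y))
  (δ-predecessor : ∀ {x m} → x < V G → δ x ≡ suc m → ∃ λ y → y < V G × δ y ≡ m × T (adj G y x))
  where

  ∈-ball⁻ : ∀ k {x} → x ∈ ball G k u → x < V G × δ x ≤ k
  ∈-ball⁻ zero (here refl) = u<V , ≤-reflexive δ-source
  ∈-ball⁻ (suc k) {x} x∈ with ∈-filter⁻ (T? ∘ _) {xs = upTo (V G)} x∈
  ... | x∈V , reached with find (any⁻ _ (ball G k u) reached)
  ... | y , y∈ , step with ∈-ball⁻ k y∈ | to T-∨ step
  ...   | _ , δy≤k | inj₁ y≡ᵇx rewrite ≡ᵇ⇒≡ y x y≡ᵇx = ∈-upTo⁻ x∈V , m≤n⇒m≤1+n δy≤k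
  ...   | _ , δy≤k | inj₂ y~x = ∈-upTo⁻ x∈V , ≤-trans (δ-lipschitz y~x) (s≤s δy≤k)

  ∈-ball⁺ : ∀ k {x} → x < V G → δ x ≤ k → x ∈ ball G k u
  ∈-ball⁺ zero x<V δx≤0 = here (δ≡0⇒source (n≤0⇒n≡0 δx≤0))
  ∈-ball⁺ (suc k) {x} x<V δx≤1+k = ∈-filter⁺ (T? ∘ _) (∈-upTo⁺ x<V) (any⁺ _ reached)
    where
      reached : Any (λ y → T ((y ≡ᵇ x) ∨ adj G y x)) (ball G k u)
      reached with δ x ≤? k
      ... | yes δx≤k = lose (∈-ball⁺ k x<V δx≤k) (from T-∨ (inj₁ (≡⇒≡ᵇ x x refl)))
      ... | no δx≰k with δ-predecessor x<V (≤-antisym δx≤1+k (≰⇒> δx≰k))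
      ...   | y , y<V , δy≡k , y~x = lose (∈-ball⁺ k y<V (≤-reflexive δy≡k)) (from T-∨ (inj₂ y~x))

  distFrom≡δ : ∀ {v} → v < V G → ∀ fuel k → k ≤ δ v → δ v ≤ k + fuel → distFrom G u v k fuel ≡ δ v
  distFrom≡δ v<V zero k k≤δ δ≤k+0 = ≤-antisym k≤δ (subst (_ ≤_) (+-identityʳ k) δ≤k+0)
  distFrom≡δ {v} v<V (suc fuel) k k≤δ δ≤ with elem v (ball G k u) in found
  ... | true = ≤-antisym k≤δ (proj₂ (∈-ball⁻ k (elem⇒∈ (ball G k u) (subst T (sym found) _))))
  ... | false with δ v ≤? k
  ...   | yes δ≤k = ⊥-elim (subst T found (∈⇒elem (∈-ball⁺ k v<V δ≤k)))
  ...   | no δ≰k = distFrom≡δ v<V fuel (suc k) (≰⇒> δ≰k) (subst (δ v ≤_) (+-suc k fuel) δ≤)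

  dist≡δ : ∀ {v} → v < V G → δ v ≤ V G → dist G u v ≡ δ v
  dist≡δ v<V δ≤V = distFrom≡δ v<V (V G) 0 z≤n δ≤V

cactusDist : ℕ → ℕ → ℕ
cactusDist zero zero = 0
cactusDist zero (suc zero) = 1
cactusDist zero (suc (suc v)) = suc (cactusDist zero v)
cactusDist (suc zero) zero = 1
cactusDist (suc zero) (suc zero) = 0
cactusDist (suc zero) (suc (suc v)) = suc (cactusDist zero v)
cactusDist (suc (suc u)) zero = suc (cactusDist u zero)
cactusDist (suc (suc u)) (suc zero) = suc (cactusDist u zero)
cactusDist (suc (suc u)) (suc (suc v)) = cactusDist u v

cactusDist-refl : ∀ u → cactusDist u u ≡ 0
cactusDist-refl zero = refl
cactusDist-refl (suc zero) = refl
cactusDist-refl (suc (suc u)) = cactusDist-refl u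

cactusDist≡0⇒≡ : ∀ u v → cactusDist u v ≡ 0 → u ≡ v
cactusDist≡0⇒≡ zero zero _ = refl
cactusDist≡0⇒≡ (suc zero) (suc zero) _ = refl
cactusDist≡0⇒≡ (suc (suc u)) (suc (suc v)) eq = cong (2 +_) (cactusDist≡0⇒≡ u v eq)
cactusDist≡0⇒≡ zero (suc zero) ()
cactusDist≡0⇒≡ zero (suc (suc v)) ()
cactusDist≡0⇒≡ (suc zero) zero ()
cactusDist≡0⇒≡ (suc zero) (suc (suc v)) ()
cactusDist≡0⇒≡ (suc (suc u)) zero ()
cactusDist≡0⇒≡ (suc (suc u)) (suc zero) ()

cactusDist-comm : ∀ u v → cactusDist u v ≡ cactusDist v u
cactusDist-comm zero zero = refl
cactusDist-comm zero (suc zero) = refl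
cactusDist-comm zero (suc (suc v)) = cong suc (cactusDist-comm 0 v)
cactusDist-comm (suc zero) zero = refl
cactusDist-comm (suc zero) (suc zero) = refl
cactusDist-comm (suc zero) (suc (suc v)) = cong suc (cactusDist-comm 0 v)
cactusDist-comm (suc (suc u)) zero = cong suc (cactusDist-comm u 0)
cactusDist-comm (suc (suc u)) (suc zero) = cong suc (cactusDist-comm u 0)
cactusDist-comm (suc (suc u)) (suc (suc v)) = cactusDist-comm u v

cactusDist≤⊔ : ∀ u v → cactusDist u v ≤ u ⊔ v
cactusDist≤⊔ zero zero = z≤n
cactusDist≤⊔ zero (suc zero) = ≤-refl
cactusDist≤⊔ zero (suc (suc v)) = s≤s (m≤n⇒m≤1+n (cactusDist≤⊔ 0 v))
cactusDist≤⊔ (suc zero) zero = ≤-refl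
cactusDist≤⊔ (suc zero) (suc zero) = z≤n
cactusDist≤⊔ (suc zero) (suc (suc v)) = s≤s (m≤n⇒m≤1+n (cactusDist≤⊔ 0 v))
cactusDist≤⊔ (suc (suc u)) zero = s≤s (m≤n⇒m≤1+n (≤-trans (cactusDist≤⊔ u 0) (≤-reflexive (⊔-identityʳ u))))
cactusDist≤⊔ (suc (suc u)) (suc zero) = s≤s (m≤n⇒m≤1+n (≤-trans (cactusDist≤⊔ u 0) (≤-reflexive (⊔-identityʳ u))))
cactusDist≤⊔ (suc (suc u)) (suc (suc v)) = m≤n⇒m≤1+n (m≤n⇒m≤1+n (cactusDist≤⊔ u v))

data Corner : Set where
  left tip right : Corner

corner : Corner → ℕ → ℕ
corner left i = 2 * i
corner tip i = 2 * i + 1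
corner right i = 2 * i + 2

corner-suc : ∀ c i → corner c (suc i) ≡ 2 + corner c i
corner-suc left i = *-suc 2 i
corner-suc tip i = cong (_+ 1) (*-suc 2 i)
corner-suc right i = cong (_+ 2) (*-suc 2 i)

corner-bounds : ∀ c i → 2 * i ≤ corner c i × corner c i ≤ 2 + 2 * i
corner-bounds left i = ≤-refl , m≤n+m (2 * i) 2
corner-bounds tip i = m≤m+n (2 * i) 1 , ≤-trans (≤-reflexive (+-comm (2 * i) 1)) (n≤1+n _)
corner-bounds right i = m≤m+n (2 * i) 2 , ≤-reflexive (+-comm (2 * i) 2)

cornerDist : Corner → Corner → ℕ
cornerDist left left = 0
cornerDist tip tip = 0
cornerDist right right = 0
cornerDist left tip = 1
cornerDist left right = 1
cornerDist tip left = 1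
cornerDist tip right = 1
cornerDist right left = 1
cornerDist right tip = 1

cornerDist≤1 : ∀ s c → cornerDist s c ≤ 1
cornerDist≤1 left left = z≤n
cornerDist≤1 left tip = ≤-refl
cornerDist≤1 left right = ≤-refl
cornerDist≤1 tip left = ≤-refl
cornerDist≤1 tip tip = z≤n
cornerDist≤1 tip right = ≤-refl
cornerDist≤1 right left = ≤-refl
cornerDist≤1 right tip = ≤-refl
cornerDist≤1 right right = z≤n

cornerDist-≢ : ∀ {s c} → c ≢ s → cornerDist s c ≡ 1
cornerDist-≢ {left} {left} c≢s = contradiction refl c≢s
cornerDist-≢ {left} {tip} _ = refl
cornerDist-≢ {left} {right} _ = refl
cornerDist-≢ {tip} {left} _ = refl
cornerDist-≢ {tip} {tip} c≢s = contradiction refl c≢s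
cornerDist-≢ {tip} {right} _ = refl
cornerDist-≢ {right} {left} _ = refl
cornerDist-≢ {right} {tip} _ = refl
cornerDist-≢ {right} {right} c≢s = contradiction refl c≢s

nearestCorner : ℕ → ℕ → Corner
nearestCorner zero zero = left
nearestCorner zero (suc zero) = tip
nearestCorner zero (suc (suc w)) = right
nearestCorner (suc i) zero = left
nearestCorner (suc i) (suc zero) = left
nearestCorner (suc i) (suc (suc w)) = nearestCorner i w

2+m≤2*[1+n]⇒m≤2*n : ∀ {i w} → 2 + w ≤ 2 * suc i → w ≤ 2 * i
2+m≤2*[1+n]⇒m≤2*n {i} {w} le = s≤s⁻¹ (s≤s⁻¹ (subst (2 + w ≤_) (*-suc 2 i) le))

nearestCorner-≤ : ∀ i w → w ≤ 2 * i → nearestCorner i w ≡ left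
nearestCorner-≤ zero zero _ = refl
nearestCorner-≤ (suc i) zero _ = refl
nearestCorner-≤ (suc i) (suc zero) _ = refl
nearestCorner-≤ (suc i) (suc (suc w)) le = nearestCorner-≤ i w (2+m≤2*[1+n]⇒m≤2*n le)

nearestCorner-≥ : ∀ i w → 2 + 2 * i ≤ w → nearestCorner i w ≡ right
nearestCorner-≥ zero (suc zero) (s≤s ())
nearestCorner-≥ zero (suc (suc w)) _ = refl
nearestCorner-≥ (suc i) (suc zero) (s≤s ())
nearestCorner-≥ (suc i) (suc (suc w)) le =
  nearestCorner-≥ i w (s≤s⁻¹ (s≤s⁻¹ (subst (λ x → 2 + x ≤ 2 + w) (*-suc 2 i) le)))

nearestCorner-tip : ∀ i → nearestCorner i (suc (2 * i)) ≡ tip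
nearestCorner-tip zero = refl
nearestCorner-tip (suc i) = subst (λ x → nearestCorner (suc i) (suc x) ≡ tip) (sym (*-suc 2 i)) (nearestCorner-tip i)

m<n⇒2+2*m≤2*n : ∀ {j i} → j < i → 2 + 2 * j ≤ 2 * i
m<n⇒2+2*m≤2*n {j} {i} j<i = subst (_≤ 2 * i) (*-suc 2 j) (*-monoʳ-≤ 2 j<i)

nearestCorner-own : ∀ c i → nearestCorner i (corner c i) ≡ c
nearestCorner-own left i = nearestCorner-≤ i (2 * i) ≤-refl
nearestCorner-own tip i = trans (cong (nearestCorner i) (+-comm (2 * i) 1)) (nearestCorner-tip i)
nearestCorner-own right i = nearestCorner-≥ i (2 * i + 2) (≤-reflexive (+-comm 2 (2 * i)))

nearestCorner-earlier : ∀ {j i} c → j < i → nearestCorner j (corner c i) ≡ right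
nearestCorner-earlier {j} {i} c j<i =
  nearestCorner-≥ j (corner c i) (≤-trans (m<n⇒2+2*m≤2*n j<i) (proj₁ (corner-bounds c i)))

nearestCorner-later : ∀ {j i} c → i < j → nearestCorner j (corner c i) ≡ left
nearestCorner-later {j} {i} c i<j =
  nearestCorner-≤ j (corner c i) (≤-trans (proj₂ (corner-bounds c i)) (m<n⇒2+2*m≤2*n i<j))

cactusDist-corner-start : ∀ i w c → (∀ x → cactusDist w (2 + x) ≡ suc (cactusDist 0 x)) →
  cactusDist w (corner c (suc i)) ≡ cornerDist left c + cactusDist w (corner left (suc i))

cactusDist-corner : ∀ i w c → let s = nearestCorner i w in
  cactusDist w (corner c i) ≡ cornerDist s c + cactusDist w (corner s i)
cactusDist-corner zero zero left = refl
cactusDist-corner zero zero tip = refl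
cactusDist-corner zero zero right = refl
cactusDist-corner zero (suc zero) left = refl
cactusDist-corner zero (suc zero) tip = refl
cactusDist-corner zero (suc zero) right = refl
cactusDist-corner zero (suc (suc w)) left = refl
cactusDist-corner zero (suc (suc w)) tip = refl
cactusDist-corner zero (suc (suc w)) right = refl
cactusDist-corner (suc i) zero c = cactusDist-corner-start i 0 c (λ _ → refl)
cactusDist-corner (suc i) (suc zero) c = cactusDist-corner-start i 1 c (λ _ → refl)
cactusDist-corner (suc i) (suc (suc w)) c = begin
  cactusDist (2 + w) (corner c (suc i))   ≡⟨ cong (cactusDist (2 + w)) (corner-suc c i) ⟩
  cactusDist w (corner c i)               ≡⟨ cactusDist-corner i w c ⟩
  cornerDist s c + cactusDist w (corner s i)
    ≡⟨ cong (λ x → cornerDist s c + cactusDist (2 + w) x) (corner-suc s i) ⟨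
  cornerDist s c + cactusDist (2 + w) (corner s (suc i)) ∎
  where open ≡-Reasoning
        s = nearestCorner i w

cactusDist-corner-start i w c start = begin
  cactusDist w (corner c (suc i))
    ≡⟨ trans (cong (cactusDist w) (corner-suc c i)) (start _) ⟩
  suc (cactusDist 0 (corner c i))
    ≡⟨ cong suc (cactusDist-corner i 0 c) ⟩
  suc (cornerDist s c + cactusDist 0 (corner s i))
    ≡⟨ cong (λ s → suc (cornerDist s c + cactusDist 0 (corner s i))) (nearestCorner-≤ i 0 z≤n) ⟩
  suc (cornerDist left c + cactusDist 0 (corner left i))
    ≡⟨ +-suc _ _ ⟨
  cornerDist left c + suc (cactusDist 0 (corner left i))
    ≡⟨ cong (cornerDist left c +_) (trans (cong (cactusDist w) (corner-suc left i)) (start _)) ⟨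
  cornerDist left c + cactusDist w (corner left (suc i)) ∎
  where open ≡-Reasoning
        s = nearestCorner i 0

nearer : Corner → Corner → Corner → Bool
nearer s a b = cornerDist s a <ᵇ cornerDist s b

cactusDist-nearer : ∀ i w a b →
  (cactusDist w (corner a i) <ᵇ cactusDist w (corner b i)) ≡ nearer (nearestCorner i w) a b
cactusDist-nearer i w a b =
  trans (cong₂ _<ᵇ_ (cactusDist-corner i w a) (cactusDist-corner i w b))
    (<ᵇ-cancelʳ (cactusDist w (corner s i)) (cornerDist s a) (cornerDist s b))
  where s = nearestCorner i w

cornerEdge : ℕ → Corner × Corner → ℕ × ℕ
cornerEdge j (a , b) = corner a j , corner b j

-- triangleEdges i is definitionally map (cornerEdge i) sides.
sides : List (Corner × Corner)
sides = (left , tip) ∷ (tip , right) ∷ (left , right) ∷ []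

joins : ℕ → ℕ → ℕ × ℕ → Bool
joins y x e = ((proj₁ e ≡ᵇ y) ∧ (proj₂ e ≡ᵇ x)) ∨ ((proj₁ e ≡ᵇ x) ∧ (proj₂ e ≡ᵇ y))

joins⁻ : ∀ {y x} e → T (joins y x e) → (y ≡ proj₁ e × x ≡ proj₂ e) ⊎ (y ≡ proj₂ e × x ≡ proj₁ e)
joins⁻ {y} {x} (a , b) t with to T-∨ t
... | inj₁ t′ = let a≡y , b≡x = to T-∧ t′ in inj₁ (sym (≡ᵇ⇒≡ a y a≡y) , sym (≡ᵇ⇒≡ b x b≡x))
... | inj₂ t′ = let a≡x , b≡y = to T-∧ t′ in inj₂ (sym (≡ᵇ⇒≡ b y b≡y) , sym (≡ᵇ⇒≡ a x a≡x))

joins-forward : ∀ y x → T (joins y x (y , x))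
joins-forward y x = from T-∨ (inj₁ (from T-∧ (≡⇒≡ᵇ y y refl , ≡⇒≡ᵇ x x refl)))

joins-backward : ∀ y x → T (joins y x (x , y))
joins-backward y x = from T-∨ (inj₂ (from T-∧ (≡⇒≡ᵇ x x refl , ≡⇒≡ᵇ y y refl)))

SameTriangle : ℕ → ℕ → Set
SameTriangle y x = ∃ λ j → ∃ λ c → ∃ λ c′ → y ≡ corner c j × x ≡ corner c′ j

joins⇒SameTriangle : ∀ j c c′ {y x} → T (joins y x (cornerEdge j (c , c′))) → SameTriangle y x
joins⇒SameTriangle j c c′ m with joins⁻ (cornerEdge j (c , c′)) m
... | inj₁ (y≡ , x≡) = j , c , c′ , y≡ , x≡
... | inj₂ (y≡ , x≡) = j , c′ , c , y≡ , x≡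

adj⇒SameTriangle : ∀ {n y x} → T (adj (chainCactus n) y x) → SameTriangle y x
adj⇒SameTriangle {n} t with satisfied (concatMap⁻ triangleEdges {xs = upTo n} (any⁻ _ (E (chainCactus n)) t))
... | j , here m = joins⇒SameTriangle j left tip m
... | j , there (here m) = joins⇒SameTriangle j tip right m
... | j , there (there (here m)) = joins⇒SameTriangle j left right m

adj-corners : ∀ {n j c c′} → j < n → c ≢ c′ → T (adj (chainCactus n) (corner c j) (corner c′ j))
adj-corners {n} {j} {c} {c′} j<n c≢c′ =
  any⁺ _ (concatMap⁺ triangleEdges (applyUpTo⁺ (λ i → i) (side c c′ c≢c′) j<n))
  where
  side : ∀ c c′ → c ≢ c′ → Any (T ∘ joins (corner c j) (corner c′ j)) (triangleEdges j)
  side left tip _ = here (joins-forward (2 * j) (2 * j + 1))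
  side tip left _ = here (joins-backward (2 * j + 1) (2 * j))
  side tip right _ = there (here (joins-forward (2 * j + 1) (2 * j + 2)))
  side right tip _ = there (here (joins-backward (2 * j + 2) (2 * j + 1)))
  side left right _ = there (there (here (joins-forward (2 * j) (2 * j + 2))))
  side right left _ = there (there (here (joins-backward (2 * j + 2) (2 * j))))
  side left left c≢c = contradiction refl c≢c
  side tip tip c≢c = contradiction refl c≢c
  side right right c≢c = contradiction refl c≢c

-- The corner of triangle j nearest to u is then a neighbour of x one step closer to u.
FarCorner : ℕ → ℕ → Set
FarCorner u x = ∃ λ j → ∃ λ c → x ≡ corner c j × c ≢ nearestCorner j u × corner tip j ≤ u ⊔ x

farCorner-shift : ∀ {u x} → FarCorner u x → FarCorner (2 + u) (2 + x)
farCorner-shift {u} {x} (j , c , x≡ , c≢ , bound) =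
  suc j , c , trans (cong (2 +_) x≡) (sym (corner-suc c j)) , c≢ ,
  subst (_≤ 2 + (u ⊔ x)) (sym (corner-suc tip j)) (s≤s (s≤s bound))

farCorner-start : ∀ {u x} → u ≤ 1 → FarCorner 0 x → FarCorner u (2 + x)
farCorner-start {u} {x} u≤1 (j , c , x≡ , c≢ , bound) =
  suc j , c , trans (cong (2 +_) x≡) (sym (corner-suc c j)) , c≢left , bound′
  where
    c≢left : c ≢ nearestCorner (suc j) u
    c≢left rewrite nearestCorner-≤ (suc j) u (≤-trans u≤1 (s≤s z≤n))
      | sym (nearestCorner-≤ j 0 z≤n) = c≢
    bound′ : corner tip (suc j) ≤ u ⊔ (2 + x)
    bound′ = ≤-trans (≤-reflexive (corner-suc tip j)) (≤-trans (s≤s (s≤s bound)) (m≤n⊔m u (2 + x)))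

farCorner : ∀ u x → u ≢ x → FarCorner u x
farCorner zero zero u≢x = contradiction refl u≢x
farCorner zero (suc zero) _ = 0 , tip , refl , (λ ()) , ≤-refl
farCorner zero (suc (suc zero)) _ = 0 , right , refl , (λ ()) , s≤s z≤n
farCorner zero (suc (suc (suc x))) _ = farCorner-start z≤n (farCorner 0 (suc x) λ ())
farCorner (suc zero) zero _ = 0 , left , refl , (λ ()) , ≤-refl
farCorner (suc zero) (suc zero) u≢x = contradiction refl u≢x
farCorner (suc zero) (suc (suc zero)) _ = 0 , right , refl , (λ ()) , s≤s z≤n
farCorner (suc zero) (suc (suc (suc x))) _ = farCorner-start ≤-refl (farCorner 0 (suc x) λ ())
farCorner (suc (suc u)) zero _ = 0 , left , refl , (λ ()) , s≤s z≤n
farCorner (suc (suc u)) (suc zero) _ = 0 , tip , refl , (λ ()) , s≤s z≤n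
farCorner (suc (suc u)) (suc (suc x)) u≢x = farCorner-shift (farCorner u x (u≢x ∘ cong (2 +_)))

corner<2*n+1 : ∀ {n j} c → j < n → corner c j < 2 * n + 1
corner<2*n+1 {n} {j} c j<n = begin-strict
  corner c j ≤⟨ below c ⟩
  2 * j + 2  ≡⟨ trans (+-comm (2 * j) 2) (sym (*-suc 2 j)) ⟩
  2 * suc j ≤⟨ *-monoʳ-≤ 2 j<n ⟩
  2 * n     <⟨ m<m+n (2 * n) (s≤s z≤n) ⟩
  2 * n + 1 ∎
  where
    open ≤-Reasoning
    below : ∀ c → corner c j ≤ 2 * j + 2
    below left = m≤m+n (2 * j) 2
    below tip = +-monoʳ-≤ (2 * j) (s≤s z≤n)
    below right = ≤-refl

corner-tip<2*n+1⇒< : ∀ {n j} → corner tip j < 2 * n + 1 → j < n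
corner-tip<2*n+1⇒< {n} {j} tip<V = *-cancelˡ-< 2 j n (+-cancelʳ-< 1 (2 * j) (2 * n) tip<V)

cactusDist-lipschitz : ∀ {n} u {y x} → T (adj (chainCactus n) y x) → cactusDist u x ≤ suc (cactusDist u y)
cactusDist-lipschitz {n} u {y} {x} t with adj⇒SameTriangle {n} {y} {x} t
... | j , c , c′ , refl , refl = begin
  cactusDist u (corner c′ j)      ≡⟨ cactusDist-corner j u c′ ⟩
  cornerDist s c′ + d             ≤⟨ +-monoˡ-≤ d (cornerDist≤1 s c′) ⟩
  suc d                           ≤⟨ s≤s (m≤n+m d _) ⟩
  suc (cornerDist s c + d)        ≡⟨ cong suc (cactusDist-corner j u c) ⟨
  suc (cactusDist u (corner c j)) ∎
  where
    open ≤-Reasoning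
    s = nearestCorner j u
    d = cactusDist u (corner s j)

cactusDist-predecessor : ∀ {n u x m} → u < 2 * n + 1 → x < 2 * n + 1 → cactusDist u x ≡ suc m →
  ∃ λ y → y < 2 * n + 1 × cactusDist u y ≡ m × T (adj (chainCactus n) y x)
cactusDist-predecessor {n} {u} {x} {m} u<V x<V ux≡
  with farCorner u x (λ { refl → 0≢1+n (trans (sym (cactusDist-refl u)) ux≡) })
... | j , c , refl , c≢s , bound = corner s j , corner<2*n+1 s j<n , d≡m , adj-corners j<n (c≢s ∘ sym)
  where
    s = nearestCorner j u
    j<n : j < n
    j<n = corner-tip<2*n+1⇒< (≤-<-trans bound (⊔-lub u<V x<V))
    d≡m : cactusDist u (corner s j) ≡ m
    d≡m = suc-injective (trans (sym (trans (cactusDist-corner j u c)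
                                            (cong (_+ cactusDist u (corner s j)) (cornerDist-≢ c≢s)))) ux≡)

dist-chainCactus : ∀ n {u v} → u < 2 * n + 1 → v < 2 * n + 1 → dist (chainCactus n) u v ≡ cactusDist u v
dist-chainCactus n {u} {v} u<V v<V =
  BreadthFirstSearch.dist≡δ (chainCactus n) u (cactusDist u) u<V (cactusDist-refl u)
    (sym ∘ cactusDist≡0⇒≡ u _) (cactusDist-lipschitz {n} u) (cactusDist-predecessor {n} u<V) v<V
    (≤-trans (cactusDist≤⊔ u v) (<⇒≤ (⊔-lub u<V v<V)))

vertexBranch : ℕ → ℕ → Corner → ℕ
vertexBranch i r left = suc (2 * i)
vertexBranch i r tip = 1
vertexBranch i r right = suc (2 * r)

vertexBranch-select : ∀ i r {a b} → a ≢ b →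
  𝟙 (nearer tip a b) + (suc (2 * i) * 𝟙 (nearer left a b) + suc (2 * r) * 𝟙 (nearer right a b))
    ≡ vertexBranch i r a
vertexBranch-select i r {left} {tip} _ = trans (m*o+n*0≡m*o (suc (2 * i)) (suc (2 * r)) 1) (*-identityʳ (suc (2 * i)))
vertexBranch-select i r {left} {right} _ = trans (m*o+n*0≡m*o (suc (2 * i)) (suc (2 * r)) 1) (*-identityʳ (suc (2 * i)))
vertexBranch-select i r {tip} {left} _ = cong suc (m*0+n*0≡0 (suc (2 * i)) (suc (2 * r)))
vertexBranch-select i r {tip} {right} _ = cong suc (m*0+n*0≡0 (suc (2 * i)) (suc (2 * r)))
vertexBranch-select i r {right} {left} _ = trans (m*0+n*o≡n*o (suc (2 * i)) (suc (2 * r)) 1) (*-identityʳ (suc (2 * r)))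
vertexBranch-select i r {right} {tip} _ = trans (m*0+n*o≡n*o (suc (2 * i)) (suc (2 * r)) 1) (*-identityʳ (suc (2 * r)))
vertexBranch-select i r {left} {left} a≢b = contradiction refl a≢b
vertexBranch-select i r {tip} {tip} a≢b = contradiction refl a≢b
vertexBranch-select i r {right} {right} a≢b = contradiction refl a≢b

nVert-chainCactus : ∀ i r {a b} → a ≢ b →
  nVert (chainCactus (suc (i + r))) (corner a i) (corner b i) ≡ vertexBranch i r a
nVert-chainCactus i r {a} {b} a≢b = begin
  count p (upTo N)                    ≡⟨ count≡sum p (upTo N) ⟩
  sum (map (𝟙 ∘ p) (upTo N))          ≡⟨ cong sum (map-upTo (𝟙 ∘ p) N) ⟩
  sum (applyUpTo (𝟙 ∘ p) N)           ≡⟨ cong (sum ∘ applyUpTo (𝟙 ∘ p)) N≡ ⟩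
  sum (applyUpTo (𝟙 ∘ p) (suc (suc (2 * i) + suc (2 * r))))
    ≡⟨ sum-applyUpTo-piecewise (suc (2 * i)) (suc (2 * r)) below at above ⟩
  𝟙 (nearer tip a b) + (suc (2 * i) * 𝟙 (nearer left a b) + suc (2 * r) * 𝟙 (nearer right a b))
    ≡⟨ vertexBranch-select i r a≢b ⟩
  vertexBranch i r a                  ∎
  where
    open ≡-Reasoning
    G = chainCactus (suc (i + r))
    N = 2 * suc (i + r) + 1
    p : ℕ → Bool
    p w = dist G w (corner a i) <ᵇ dist G w (corner b i)
    N≡ : 2 * suc (i + r) + 1 ≡ suc (suc (2 * i) + suc (2 * r))
    N≡ = solve (i ∷ r ∷ [])
    i<n : i < suc (i + r)
    i<n = s≤s (m≤m+n i r)
    term : ∀ {w} → w < suc (suc (2 * i) + suc (2 * r)) → 𝟙 (p w) ≡ 𝟙 (nearer (nearestCorner i w) a b)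
    term {w} w< = cong 𝟙 (trans
      (cong₂ _<ᵇ_ (dist-chainCactus (suc (i + r)) w<N (corner<2*n+1 a i<n))
                  (dist-chainCactus (suc (i + r)) w<N (corner<2*n+1 b i<n)))
      (cactusDist-nearer i w a b))
      where w<N = subst (w <_) (sym N≡) w<
    below : ∀ {w} → w < suc (2 * i) → 𝟙 (p w) ≡ 𝟙 (nearer left a b)
    below {w} w< = trans (term (<-≤-trans w< (m≤n⇒m≤1+n (m≤m+n _ _))))
                         (cong (λ s → 𝟙 (nearer s a b)) (nearestCorner-≤ i w (s≤s⁻¹ w<)))
    at : 𝟙 (p (suc (2 * i))) ≡ 𝟙 (nearer tip a b)
    at = trans (term (s≤s (m≤m+n _ _))) (cong (λ s → 𝟙 (nearer s a b)) (nearestCorner-tip i))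
    above : ∀ {w} → suc (2 * i) < w → w < suc (suc (2 * i) + suc (2 * r)) → 𝟙 (p w) ≡ 𝟙 (nearer right a b)
    above {w} 2+2i≤w w< = trans (term w<) (cong (λ s → 𝟙 (nearer s a b)) (nearestCorner-≥ i w 2+2i≤w))

edgeDist : Corner → Corner × Corner → ℕ
edgeDist s (x , y) = cornerDist s x ⊓ cornerDist s y

distVE-chainCactus : ∀ {n w j s} e → w < 2 * n + 1 → j < n → nearestCorner j w ≡ s →
  distVE (chainCactus n) w (cornerEdge j e) ≡ edgeDist s e + cactusDist w (corner s j)
distVE-chainCactus {n} {w} {j} (x , y) w<V j<n refl = begin
  dist G w (corner x j) ⊓ dist G w (corner y j)
    ≡⟨ cong₂ _⊓_ (dist-chainCactus n w<V (corner<2*n+1 x j<n)) (dist-chainCactus n w<V (corner<2*n+1 y j<n)) ⟩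
  cactusDist w (corner x j) ⊓ cactusDist w (corner y j)
    ≡⟨ cong₂ _⊓_ (cactusDist-corner j w x) (cactusDist-corner j w y) ⟩
  (cornerDist s x + d) ⊓ (cornerDist s y + d)
    ≡⟨ +-distribʳ-⊓ d (cornerDist s x) (cornerDist s y) ⟨
  edgeDist s (x , y) + d ∎
  where
    open ≡-Reasoning
    G = chainCactus n
    s = nearestCorner j w
    d = cactusDist w (corner s j)

-- Both a and b reach triangle j through its corner s, so a side of j is closer to a than to b
-- exactly when s is.
distVE-<ᵇ-remote : ∀ {n i j} a b s e → i < n → j < n →
  nearestCorner j (corner a i) ≡ s → nearestCorner j (corner b i) ≡ s →
  (distVE (chainCactus n) (corner a i) (cornerEdge j e) <ᵇ distVE (chainCactus n) (corner b i) (cornerEdge j e))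
    ≡ nearer (nearestCorner i (corner s j)) a b
distVE-<ᵇ-remote {n} {i} {j} a b s e i<n j<n near-a near-b = begin
  distVE G (corner a i) (cornerEdge j e) <ᵇ distVE G (corner b i) (cornerEdge j e)
    ≡⟨ cong₂ _<ᵇ_ (distVE-chainCactus e (corner<2*n+1 a i<n) j<n near-a)
                  (distVE-chainCactus e (corner<2*n+1 b i<n) j<n near-b) ⟩
  edgeDist s e + cactusDist (corner a i) (corner s j) <ᵇ edgeDist s e + cactusDist (corner b i) (corner s j)
    ≡⟨ <ᵇ-cancelˡ (edgeDist s e) _ _ ⟩
  cactusDist (corner a i) (corner s j) <ᵇ cactusDist (corner b i) (corner s j)
    ≡⟨ cong₂ _<ᵇ_ (cactusDist-comm (corner a i) (corner s j)) (cactusDist-comm (corner b i) (corner s j)) ⟩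
  cactusDist (corner s j) (corner a i) <ᵇ cactusDist (corner s j) (corner b i)
    ≡⟨ cactusDist-nearer i (corner s j) a b ⟩
  nearer (nearestCorner i (corner s j)) a b ∎
  where
    open ≡-Reasoning
    G = chainCactus n

distVE-<ᵇ-own : ∀ {n i} a b e → i < n →
  (distVE (chainCactus n) (corner a i) (cornerEdge i e) <ᵇ distVE (chainCactus n) (corner b i) (cornerEdge i e))
    ≡ (edgeDist a e <ᵇ edgeDist b e)
distVE-<ᵇ-own {n} {i} a b e i<n = begin
  distVE G (corner a i) (cornerEdge i e) <ᵇ distVE G (corner b i) (cornerEdge i e)
    ≡⟨ cong₂ _<ᵇ_ (distVE-chainCactus e (corner<2*n+1 a i<n) i<n (nearestCorner-own a i))
                  (distVE-chainCactus e (corner<2*n+1 b i<n) i<n (nearestCorner-own b i)) ⟩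
  edgeDist a e + cactusDist (corner a i) (corner a i) <ᵇ edgeDist b e + cactusDist (corner b i) (corner b i)
    ≡⟨ cong₂ (λ x y → edgeDist a e + x <ᵇ edgeDist b e + y)
             (cactusDist-refl (corner a i)) (cactusDist-refl (corner b i)) ⟩
  edgeDist a e + 0 <ᵇ edgeDist b e + 0
    ≡⟨ <ᵇ-cancelʳ 0 (edgeDist a e) (edgeDist b e) ⟩
  edgeDist a e <ᵇ edgeDist b e ∎
  where
    open ≡-Reasoning
    G = chainCactus n

edgeBranch : ℕ → ℕ → Corner → ℕ
edgeBranch i r left = i * 3
edgeBranch i r tip = 0
edgeBranch i r right = r * 3

ownTriangleCount : Corner → Corner → ℕ
ownTriangleCount a b = sum (map (λ e → 𝟙 (edgeDist a e <ᵇ edgeDist b e)) sides)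

edgeBranch-select : ∀ i r {a b} → a ≢ b →
  ownTriangleCount a b + (i * (3 * 𝟙 (nearer left a b)) + r * (3 * 𝟙 (nearer right a b)))
    ≡ suc (edgeBranch i r a)
edgeBranch-select i r {left} {tip} _ = cong suc (m*o+n*0≡m*o i r 3)
edgeBranch-select i r {left} {right} _ = cong suc (m*o+n*0≡m*o i r 3)
edgeBranch-select i r {tip} {left} _ = cong suc (m*0+n*0≡0 i r)
edgeBranch-select i r {tip} {right} _ = cong suc (m*0+n*0≡0 i r)
edgeBranch-select i r {right} {left} _ = cong suc (m*0+n*o≡n*o i r 3)
edgeBranch-select i r {right} {tip} _ = cong suc (m*0+n*o≡n*o i r 3)
edgeBranch-select i r {left} {left} a≢b = contradiction refl a≢b
edgeBranch-select i r {tip} {tip} a≢b = contradiction refl a≢b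
edgeBranch-select i r {right} {right} a≢b = contradiction refl a≢b

mEdge-chainCactus : ∀ i r {a b} → a ≢ b →
  mEdge (chainCactus (suc (i + r))) (corner a i) (corner b i) ≡ suc (edgeBranch i r a)
mEdge-chainCactus i r {a} {b} a≢b = begin
  count p (E G)                                               ≡⟨ count≡sum p (E G) ⟩
  sum (map (𝟙 ∘ p) (concatMap triangleEdges (upTo n)))         ≡⟨ sum-map-concatMap (𝟙 ∘ p) triangleEdges (upTo n) ⟩
  sum (map (sum ∘ map (𝟙 ∘ p) ∘ triangleEdges) (upTo n))      ≡⟨ cong sum (map-upTo _ n) ⟩
  sum (applyUpTo (sum ∘ map (𝟙 ∘ p) ∘ triangleEdges) n)       ≡⟨ sum-applyUpTo-piecewise i r below at above ⟩
  ownTriangleCount a b + (i * (3 * 𝟙 (nearer left a b)) + r * (3 * 𝟙 (nearer right a b)))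
                                                              ≡⟨ edgeBranch-select i r a≢b ⟩
  suc (edgeBranch i r a)                                      ∎
  where
    open ≡-Reasoning
    n = suc (i + r)
    G = chainCactus n
    p : ℕ × ℕ → Bool
    p f = distVE G (corner a i) f <ᵇ distVE G (corner b i) f
    i<n : i < n
    i<n = s≤s (m≤m+n i r)
    below : ∀ {j} → j < i → sum (map (𝟙 ∘ p) (triangleEdges j)) ≡ 3 * 𝟙 (nearer left a b)
    below {j} j<i = cong sum (map-cong (λ e → cong 𝟙 (trans
      (distVE-<ᵇ-remote a b right e i<n (<-trans j<i i<n) (nearestCorner-earlier a j<i) (nearestCorner-earlier b j<i))
      (cong (λ s → nearer s a b) (nearestCorner-later right j<i)))) sides)
    above : ∀ {j} → i < j → j < n → sum (map (𝟙 ∘ p) (triangleEdges j)) ≡ 3 * 𝟙 (nearer right a b)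
    above {j} i<j j<n = cong sum (map-cong (λ e → cong 𝟙 (trans
      (distVE-<ᵇ-remote a b left e i<n j<n (nearestCorner-later a i<j) (nearestCorner-later b i<j))
      (cong (λ s → nearer s a b) (nearestCorner-earlier left i<j)))) sides)
    at : sum (map (𝟙 ∘ p) (triangleEdges i)) ≡ ownTriangleCount a b
    at = cong sum (map-cong (λ e → cong 𝟙 (distVE-<ᵇ-own a b e i<n)) sides)

vertexImbalance : Graph → ℕ × ℕ → ℕ
vertexImbalance G e = ∣ nVert G (proj₁ e) (proj₂ e) - nVert G (proj₂ e) (proj₁ e) ∣

edgeImbalance : Graph → ℕ × ℕ → ℕ
edgeImbalance G e = ∣ mEdge G (proj₁ e) (proj₂ e) - mEdge G (proj₂ e) (proj₁ e) ∣

imbalance-sides : ∀ (m : Corner → Corner → ℕ) (w : Corner → ℕ) → (∀ {a b} → a ≢ b → m a b ≡ w a) →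
  sum (map (λ e → ∣ m (proj₁ e) (proj₂ e) - m (proj₂ e) (proj₁ e) ∣) sides)
    ≡ ∣ w left - w tip ∣ + (∣ w tip - w right ∣ + (∣ w left - w right ∣ + 0))
imbalance-sides m w m≡w =
  cong₂ _+_ (cong₂ ∣_-_∣ (m≡w λ ()) (m≡w λ ()))
    (cong₂ _+_ (cong₂ ∣_-_∣ (m≡w λ ()) (m≡w λ ()))
      (cong (_+ 0) (cong₂ ∣_-_∣ (m≡w λ ()) (m≡w λ ()))))

branch-imbalance : ∀ x z → ∣ suc x - 1 ∣ + (∣ 1 - suc z ∣ + (∣ suc x - suc z ∣ + 0)) ≡ 2 * (x ⊔ z)
branch-imbalance x z =
  trans (cong₂ _+_ (∣-∣-identityʳ x) (cong (z +_) (+-identityʳ ∣ x - z ∣))) (+-∣-∣≡2*⊔ x z)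

triangle-Mo : ∀ i r → sum (map (vertexImbalance (chainCactus (suc (i + r)))) (triangleEdges i)) ≡ 4 * (i ⊔ r)
triangle-Mo i r = begin
  sum (map (vertexImbalance (chainCactus (suc (i + r)))) (triangleEdges i))
    ≡⟨ imbalance-sides _ (vertexBranch i r) (nVert-chainCactus i r) ⟩
  ∣ suc (2 * i) - 1 ∣ + (∣ 1 - suc (2 * r) ∣ + (∣ suc (2 * i) - suc (2 * r) ∣ + 0))
    ≡⟨ branch-imbalance (2 * i) (2 * r) ⟩
  2 * (2 * i ⊔ 2 * r)
    ≡⟨ 2*[m*n⊔m*o]≡2*m*[n⊔o] 2 i r ⟩
  4 * (i ⊔ r) ∎
  where open ≡-Reasoning

triangle-Moe : ∀ i r → sum (map (edgeImbalance (chainCactus (suc (i + r)))) (triangleEdges i)) ≡ 6 * (i ⊔ r)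
triangle-Moe i r = begin
  sum (map (edgeImbalance (chainCactus (suc (i + r)))) (triangleEdges i))
    ≡⟨ imbalance-sides _ (suc ∘ edgeBranch i r) (mEdge-chainCactus i r) ⟩
  ∣ suc (i * 3) - 1 ∣ + (∣ 1 - suc (r * 3) ∣ + (∣ suc (i * 3) - suc (r * 3) ∣ + 0))
    ≡⟨ branch-imbalance (i * 3) (r * 3) ⟩
  2 * (i * 3 ⊔ r * 3)
    ≡⟨ cong₂ (λ x y → 2 * (x ⊔ y)) (*-comm i 3) (*-comm r 3) ⟩
  2 * (3 * i ⊔ 3 * r)
    ≡⟨ 2*[m*n⊔m*o]≡2*m*[n⊔o] 3 i r ⟩
  6 * (i ⊔ r) ∎
  where open ≡-Reasoning

-- The number of triangles on the heavier side of triangle i.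
maxBranch : ℕ → ℕ → ℕ
maxBranch n i = i ⊔ (n ∸ suc i)

maxBranchSum : ℕ → ℕ
maxBranchSum n = sum (applyUpTo (maxBranch n) n)

sum-over-triangles : ∀ (h : ℕ → ℕ × ℕ → ℕ) c →
  (∀ i r → sum (map (h (suc (i + r))) (triangleEdges i)) ≡ c * (i ⊔ r)) →
  ∀ n → sum (map (h n) (E (chainCactus n))) ≡ c * maxBranchSum n
sum-over-triangles h c triangle n = begin
  sum (map (h n) (concatMap triangleEdges (upTo n)))         ≡⟨ sum-map-concatMap (h n) triangleEdges (upTo n) ⟩
  sum (map (sum ∘ map (h n) ∘ triangleEdges) (upTo n))       ≡⟨ cong sum (map-upTo _ n) ⟩
  sum (applyUpTo (sum ∘ map (h n) ∘ triangleEdges) n)        ≡⟨ sum-applyUpTo-cong n triangle′ ⟩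
  sum (applyUpTo (λ i → c * maxBranch n i) n)               ≡⟨ sum-applyUpTo-* c (maxBranch n) n ⟩
  c * maxBranchSum n                                         ∎
  where
    open ≡-Reasoning
    triangle′ : ∀ {n i} → i < n → sum (map (h n) (triangleEdges i)) ≡ c * maxBranch n i
    triangle′ {n} {i} i<n with n ∸ suc i | m+[n∸m]≡n i<n
    ... | r | refl = triangle i r

Mo-chainCactus : ∀ n → Mo (chainCactus n) ≡ 4 * maxBranchSum n
Mo-chainCactus = sum-over-triangles (vertexImbalance ∘ chainCactus) 4 triangle-Mo

Moe-chainCactus : ∀ n → Moe (chainCactus n) ≡ 6 * maxBranchSum n
Moe-chainCactus = sum-over-triangles (edgeImbalance ∘ chainCactus) 6 triangle-Moe

maxBranchSum-step : ∀ n → maxBranchSum (2 + n) ≡ suc n + (n + maxBranchSum n + suc n)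
maxBranchSum-step n = cong (suc n +_) (begin
  sum (applyUpTo (maxBranch (2 + n) ∘ suc) (suc n))
    ≡⟨ sum-applyUpTo-last (maxBranch (2 + n) ∘ suc) n ⟩
  sum (applyUpTo (maxBranch (2 + n) ∘ suc) n) + (suc n ⊔ (n ∸ n))
    ≡⟨ cong₂ _+_ (sum-applyUpTo-cong n shift) (cong (suc n ⊔_) (n∸n≡0 n)) ⟩
  sum (applyUpTo (suc ∘ maxBranch n) n) + suc n
    ≡⟨ cong (_+ suc n) (sum-applyUpTo-suc (maxBranch n) n) ⟩
  n + maxBranchSum n + suc n ∎)
  where
    open ≡-Reasoning
    shift : ∀ {i} → i < n → maxBranch (2 + n) (suc i) ≡ suc (maxBranch n i)
    shift {i} i<n = cong (suc i ⊔_) (+-∸-assoc 1 i<n)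

maxBranchSum-even : ∀ k → maxBranchSum (2 * k) + k ≡ 3 * k * k
maxBranchSum-even zero = refl
maxBranchSum-even (suc k) = begin
  maxBranchSum (2 * suc k) + suc k                       ≡⟨ cong (λ m → maxBranchSum m + suc k) (*-suc 2 k) ⟩
  maxBranchSum (2 + 2 * k) + suc k                       ≡⟨ cong (_+ suc k) (maxBranchSum-step (2 * k)) ⟩
  suc (2 * k) + (2 * k + s + suc (2 * k)) + suc k        ≡⟨ rearrange k s ⟩
  (s + k) + (6 * k + 3)                                  ≡⟨ cong (_+ (6 * k + 3)) (maxBranchSum-even k) ⟩
  3 * k * k + (6 * k + 3)                                ≡⟨ solve (k ∷ []) ⟩
  3 * suc k * suc k                                      ∎
  where
    open ≡-Reasoning
    s = maxBranchSum (2 * k)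
    rearrange : ∀ k s → suc (2 * k) + (2 * k + s + suc (2 * k)) + suc k ≡ (s + k) + (6 * k + 3)
    rearrange = solve-∀

maxBranchSum-odd : ∀ k → maxBranchSum (2 * k + 1) ≡ 3 * k * k + 2 * k
maxBranchSum-odd zero = refl
maxBranchSum-odd (suc k) = begin
  maxBranchSum (2 * suc k + 1)                           ≡⟨ cong (λ m → maxBranchSum (m + 1)) (*-suc 2 k) ⟩
  maxBranchSum (2 + (2 * k + 1))                         ≡⟨ maxBranchSum-step (2 * k + 1) ⟩
  suc (2 * k + 1) + (2 * k + 1 + s + suc (2 * k + 1))    ≡⟨ rearrange k s ⟩
  s + (6 * k + 5)                                        ≡⟨ cong (_+ (6 * k + 5)) (maxBranchSum-odd k) ⟩
  3 * k * k + 2 * k + (6 * k + 5)                        ≡⟨ solve (k ∷ []) ⟩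
  3 * suc k * suc k + 2 * suc k                          ∎
  where
    open ≡-Reasoning
    s = maxBranchSum (2 * k + 1)
    rearrange : ∀ k s → suc (2 * k + 1) + (2 * k + 1 + s + suc (2 * k + 1)) ≡ s + (6 * k + 5)
    rearrange = solve-∀

*-maxBranchSum-even : ∀ c k → c * maxBranchSum (2 * k) ≡ c * (3 * k * k) ∸ c * k
*-maxBranchSum-even c k = begin
  c * s                    ≡⟨ m+n∸n≡m (c * s) (c * k) ⟨
  c * s + c * k ∸ c * k    ≡⟨ cong (_∸ c * k) (*-distribˡ-+ c s k) ⟨
  c * (s + k) ∸ c * k      ≡⟨ cong (λ x → c * x ∸ c * k) (maxBranchSum-even k) ⟩
  c * (3 * k * k) ∸ c * k  ∎
  where
    open ≡-Reasoning
    s = maxBranchSum (2 * k)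

mainTheorem10 : ∀ (k : ℕ) → k ≥ 1 →
      ((Mo (chainCactus (2 * k)) ≡ 12 * k * k ∸ 4 * k)
        × (Mo (chainCactus (2 * k + 1)) ≡ 12 * k * k + 8 * k))
    × ((Moe (chainCactus (2 * k)) ≡ 18 * k * k ∸ 6 * k)
        × (Moe (chainCactus (2 * k + 1)) ≡ 18 * k * k + 12 * k))
mainTheorem10 k _ =
  ( trans (Mo-chainCactus (2 * k)) (trans (*-maxBranchSum-even 4 k) (cong (_∸ 4 * k) (solve (k ∷ []))))
  , trans (Mo-chainCactus (2 * k + 1)) (trans (cong (4 *_) (maxBranchSum-odd k)) (solve (k ∷ []))) )
  , ( trans (Moe-chainCactus (2 * k)) (trans (*-maxBranchSum-even 6 k) (cong (_∸ 6 * k) (solve (k ∷ []))))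
  , trans (Moe-chainCactus (2 * k + 1)) (trans (cong (6 *_) (maxBranchSum-odd k)) (solve (k ∷ []))) )
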